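{- Let $t(n)$ denote the minimum of $\operatorname{th_{mdim}}(T)$ over all trees $T$ of order $n$. Then $t(n)=\Theta(n^{1/2})$.
   Context: $\operatorname{dist}(u,v)$ is the shortest-path distance. For an edge $e=\{u,w\}$ and vertex $v$, $\operatorname{dist}(e,v)=\min(\operatorname{dist}(u,v),\operatorname{dist}(w,v))$. For a nonnegative integer $r$ and $a\in V(G)\cup E(G)$, $\operatorname{dist}_r(a,v)=\min(\operatorname{dist}(a,v),r+1)$. A set $S\subseteq V(G)$ is a distance-$r$ mixed resolving set if for all distinct $a,b\in V(G)\cup E(G)$ there is $v\in S$ with $\operatorname{dist}_r(v,a)\ne\operatorname{dist}_r(v,b)$. $\operatorname{mdim}_r(G)$ is the minimum size of such a set and $\operatorname{th_{mdim}}(G)=\min_{r\ge0}(r+\operatorname{mdim}_r(G))$ over nonnegative integers $r$. -}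

module Defs where

open import Data.Nat using (ℕ; zero; suc; _+_; _*_; _^_; _≤_; _<_)
open import Data.Bool using (Bool; true; false; _∨_; _∧_; if_then_else_)
open import Data.Fin using (Fin; toℕ)
open import Data.Fin.Properties using (_≟_)
open import Data.Fin.Subset using (Subset; _∈_; ∣_∣)
open import Data.List using (List; []; _∷_; allFin; length)
open import Data.Bool.ListAction using (any)
open import Data.List.Relation.Unary.Unique.Propositional using (Unique)
open import Data.Product using (Σ; ∃; _×_; _,_)
open import Relation.Binary.PropositionalEquality using (_≡_; _≢_)
open import Relation.Nullary.Decidable using (⌊_⌋)
open import Relation.Nullary using (¬_)

record Graph (n : ℕ) : Set where
  field
    adj    : Fin n → Fin n → Bool
    sym    : ∀ u v → adj u v ≡ adj v u
    irrefl : ∀ u → adj u u ≡ false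
open Graph public

module _ {n : ℕ} (G : Graph n) where

  within : ℕ → Fin n → Fin n → Bool
  within zero    u v = ⌊ u ≟ v ⌋
  within (suc k) u v = within k u v ∨ any (λ w → adj G u w ∧ within k w v) (allFin n)

  private
    search : Fin n → Fin n → ℕ → ℕ → ℕ
    search u v i zero       = if within i u v then i else suc i
    search u v i (suc fuel) = if within i u v then i else search u v (suc i) fuel

  -- dist_r(u,v) = min(dist(u,v), r+1)
  distR : ℕ → Fin n → Fin n → ℕ
  distR r u v = search u v 0 r

  Connected : Set
  Connected = ∀ u v → ∃ λ k → within k u v ≡ true

  data WalkFrom : Fin n → List (Fin n) → Fin n → Set where
    stop : ∀ {v} → WalkFrom v [] v
    step : ∀ {u w vs v} → adj G u w ≡ true → WalkFrom w vs v → WalkFrom u (w ∷ vs) v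

  record Cycle : Set where
    field
      start  : Fin n
      rest   : List (Fin n)
      end    : Fin n
      walk   : WalkFrom start rest end
      long   : 2 ≤ length rest
      closed : adj G end start ≡ true
      unique : Unique (start ∷ rest)

  Acyclic : Set
  Acyclic = ¬ Cycle

  IsTree : Set
  IsTree = Connected × Acyclic

  -- elements of V(G) ∪ E(G); an edge {u,w} is recorded once, with u < w
  data Elem : Set where
    vert : Fin n → Elem
    edge : (u w : Fin n) → toℕ u < toℕ w → adj G u w ≡ true → Elem

  distRE : ℕ → Elem → Fin n → ℕ
  distRE r (vert u)       v = distR r u v
  distRE r (edge u w _ _) v = Data.Nat._⊓_ (distR r u v) (distR r w v)

  IsMixedResolving : ℕ → Subset n → Set
  IsMixedResolving r S =
    ∀ (a b : Elem) → a ≢ b → ∃ λ v → v ∈ S × distRE r a v ≢ distRE r b v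

TAtMost : ℕ → ℕ → Set
TAtMost n k = Σ (Graph n) λ T → IsTree T × ∃ λ r → ∃ λ S →
  IsMixedResolving T r S × r + ∣ S ∣ ≤ k

-- m = t(n) = min over trees T of order n of th_mdim(T) = min_r (r + mdim_r(T))
IsT : ℕ → ℕ → Set
IsT n m = TAtMost n m × (∀ k → TAtMost n k → m ≤ k)

-- Upper bound: on the path with n vertices take r = L = ⌊√n⌋ and as landmarks the vertices
-- at the multiples of L together with the last vertex.  Two elements with different lower
-- ends a < b are told apart by the landmark just below a (its distance to a is < L), and a
-- vertex x from the edge {x, x+1} by the next landmark above x.  So t(n) ≤ L + n/L + 2 ≤ 5L.
--
-- Lower bound: root a tree T.  For a non-root vertex p, some landmark v of a distance-r mixed
-- resolving set S tells the vertex parent(p) from the edge {p, parent(p)}; then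
-- d(p, v) < d(parent(p), v), so e = d(p, v) ≤ r and p is the e-th ancestor of v.  Hence
-- p ↦ (v, e) is injective and n - 1 ≤ |S| (r + 1) ≤ m (m + 1) for m = r + |S|.
--
-- The minimum t(n) exists constructively because th_mdim(T) ≤ k is decidable: there are
-- finitely many graphs on n vertices, thresholds r ≤ k and sets S.

module Submission where

open import Defs hiding (sym)
open import Data.Bool using (Bool; true; false; _∨_; _∧_)
open import Data.Bool.Properties using (∨-zeroʳ; ∧-conicalˡ; ∧-conicalʳ; T-≡)
import Data.Bool.Properties as Bool
open import Data.Bool.ListAction using (any; or)
open import Axiom.UniquenessOfIdentityProofs using (module Decidable⇒UIP)
open import Data.Empty using (⊥)
open import Data.Fin as Fin using (Fin; toℕ)
import Data.Fin.Properties as Fin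
open import Data.Fin.Subset using (Subset; _∈_; ∣_∣)
open import Data.Fin.Subset.Properties using (_∈?_; anySubset?)
open import Data.Vec as Vec using (_∷_; here; there; tabulate)
open import Data.Vec.Properties using (lookup∘tabulate; lookup⇒[]=; []=⇒lookup)
open import Data.List using (List; []; _∷_; [_]; _++_; allFin; length; lookup)
open import Data.List.Properties using (length-++-≤ˡ; map-cong)
open import Data.List.Relation.Unary.All as All using (All; []; _∷_)
import Data.List.Relation.Unary.All.Properties as All
open import Data.List.Relation.Unary.AllPairs using ([]; _∷_; allPairs?)
import Data.List.Relation.Unary.AllPairs.Properties as AllPairs
open import Data.List.Relation.Unary.Unique.Propositional using (Unique)
open import Data.List.Membership.Propositional using (lose) renaming (_∈_ to _∈ˡ_)
open import Data.List.Membership.Propositional.Properties using (∈-allFin; ∈-lookup)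
open import Data.List.Relation.Unary.Any using (satisfied)
open import Data.List.Relation.Unary.Any.Properties using (any⁺; any⁻)
open import Data.Nat
open import Data.Nat.Properties
open import Data.Nat.Solver using (module +-*-Solver)
open import Data.Nat.DivMod using (m≡m%n+[m/n]*n; m%n<n; m*n%n≡0; m/n*n≤m; /-monoˡ-≤; m<n*o⇒m/o<n)
open import Data.Product as × using (Σ; ∃; _×_; _,_; proj₁; proj₂; map₂; uncurry)
open import Data.Product.Properties using (,-injectiveˡ; ,-injectiveʳ)
import Data.Product.Properties as ×
import Data.Sum.Properties as ⊎
open import Data.Sum as Sum using (_⊎_; inj₁; inj₂)
open import Function.Base using (_∘_)
open import Function.Bundles using (Equivalence)
open +-*-Solver using (solve; _:+_; _:*_; _:=_; con)
open import Relation.Binary.PropositionalEquality hiding ([_])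
open import Relation.Binary.Definitions using (DecidableEquality; tri<; tri≈; tri>)
open import Relation.Nullary using (¬_; Dec; yes; no; contradiction)
open import Relation.Nullary.Decidable
  using (⌊_⌋; dec-true; isYes≗does; toWitness; map′; _⊎-dec_; _×-dec_; _→-dec_; ¬?)
open import Relation.Unary using (Decidable)

-- Finite search and counting

least : {P : ℕ → Set} → Decidable P → ∀ {k} → P k → ∃ λ m → P m × (∀ j → P j → m ≤ j)
least P? {zero} p = 0 , p , λ _ _ → z≤n
least P? {suc k} p with P? 0
... | yes p₀ = 0 , p₀ , λ _ _ → z≤n
... | no ¬p₀ with least (λ j → P? (suc j)) p
... | m , pm , minimal = suc m , pm , λ
  { zero p₀ → contradiction p₀ ¬p₀
  ; (suc j) pj → s≤s (minimal j pj) }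

module _ {A : Set} (p : A → Bool) where

  any-≡true⁺ : ∀ {x xs} → x ∈ˡ xs → p x ≡ true → any p xs ≡ true
  any-≡true⁺ x∈xs px = Equivalence.to T-≡ (any⁺ p (lose x∈xs (Equivalence.from T-≡ px)))

  any-≡true⁻ : ∀ xs → any p xs ≡ true → ∃ λ x → p x ≡ true
  any-≡true⁻ xs e = map₂ (Equivalence.to T-≡) (satisfied (any⁻ p xs (Equivalence.from T-≡ e)))

∨-≡true⁻ : ∀ a {b} → a ∨ b ≡ true → a ≡ true ⊎ b ≡ true
∨-≡true⁻ true  _ = inj₁ refl
∨-≡true⁻ false e = inj₂ e

rank : ∀ {n} (S : Subset n) {x} → x ∈ S → Fin ∣ S ∣
rank (true  ∷ S) here      = Fin.zero
rank (true  ∷ S) (there m) = Fin.suc (rank S m)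
rank (false ∷ S) (there m) = rank S m

rank-injective : ∀ {n} (S : Subset n) {x y} (x∈S : x ∈ S) (y∈S : y ∈ S) →
                 rank S x∈S ≡ rank S y∈S → x ≡ y
rank-injective (true  ∷ S) here       here       _ = refl
rank-injective (true  ∷ S) (there x∈) (there y∈) e = cong Fin.suc (rank-injective S x∈ y∈ (Fin.suc-injective e))
rank-injective (false ∷ S) (there x∈) (there y∈) e = cong Fin.suc (rank-injective S x∈ y∈ e)

combine-injective : ∀ {m k} {a a′ : Fin m} {b b′ : Fin k} →
                    Fin.combine a b ≡ Fin.combine a′ b′ → a ≡ a′ × b ≡ b′
combine-injective {k = k} {a} {a′} {b} {b′} e = ,-injectiveˡ eq , ,-injectiveʳ eq
  where
  eq : (a , b) ≡ (a′ , b′)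
  eq = trans (sym (Fin.remQuot-combine a b)) (trans (cong (Fin.remQuot k) e) (Fin.remQuot-combine a′ b′))

member : ∀ {n} (S : Subset n) → Fin ∣ S ∣ → Fin n
member (true  ∷ S) Fin.zero    = Fin.zero
member (true  ∷ S) (Fin.suc i) = Fin.suc (member S i)
member (false ∷ S) i           = Fin.suc (member S i)

member-∈ : ∀ {n} (S : Subset n) i → member S i ∈ S
member-∈ (true  ∷ S) Fin.zero    = here
member-∈ (true  ∷ S) (Fin.suc i) = there (member-∈ S i)
member-∈ (false ∷ S) i           = there (member-∈ S i)

member-injective : ∀ {n} (S : Subset n) {i j} → member S i ≡ member S j → i ≡ j
member-injective (true  ∷ S) {Fin.zero}  {Fin.zero}  _ = refl
member-injective (true  ∷ S) {Fin.suc i} {Fin.suc j} e = cong Fin.suc (member-injective S (Fin.suc-injective e))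
member-injective (false ∷ S)                         e = member-injective S (Fin.suc-injective e)

injectiveOn⇒∣S∣≤ : ∀ {n q} (S : Subset n) (f : Fin n → Fin q) →
                   (∀ {x y} → x ∈ S → y ∈ S → f x ≡ f y → x ≡ y) → ∣ S ∣ ≤ q
injectiveOn⇒∣S∣≤ S f injective = Fin.injective⇒≤ {f = λ i → f (member S i)}
  (λ e → member-injective S (injective (member-∈ S _) (member-∈ S _) e))

module _ {n : ℕ} {P : Fin n → Set} (P? : Decidable P) where

  ∈-tabulate⁺ : ∀ {x} → P x → x ∈ tabulate (λ y → ⌊ P? y ⌋)
  ∈-tabulate⁺ {x} px =
    lookup⇒[]= x _ (trans (lookup∘tabulate _ x) (trans (isYes≗does (P? x)) (dec-true (P? x) px)))

  ∈-tabulate⁻ : ∀ {x} → x ∈ tabulate (λ y → ⌊ P? y ⌋) → P x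
  ∈-tabulate⁻ {x} x∈ = toWitness (Equivalence.from T-≡ (trans (sym (lookup∘tabulate _ x)) ([]=⇒lookup x∈)))

unique-lookup-injective : ∀ {A : Set} {xs : List A} → Unique xs →
                          ∀ {i j} → lookup xs i ≡ lookup xs j → i ≡ j
unique-lookup-injective (_  ∷ _) {Fin.zero}  {Fin.zero}  _ = refl
unique-lookup-injective (x≢ ∷ _) {Fin.zero}  {Fin.suc j} e = contradiction e (All.lookup x≢ (∈-lookup j))
unique-lookup-injective (x≢ ∷ _) {Fin.suc i} {Fin.zero}  e = contradiction (sym e) (All.lookup x≢ (∈-lookup i))
unique-lookup-injective (_  ∷ u) {Fin.suc i} {Fin.suc j} e = cong Fin.suc (unique-lookup-injective u e)

unique⇒length≤ : ∀ {n} {xs : List (Fin n)} → Unique xs → length xs ≤ n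
unique⇒length≤ u = Fin.injective⇒≤ (unique-lookup-injective u)

ShortWitness : ∀ {n} → ℕ → (List (Fin n) → Set) → Set
ShortWitness B P = ∃ λ xs → length xs ≤ B × P xs

any-list≤? : ∀ {n} B {P : List (Fin n) → Set} → Decidable P → Dec (ShortWitness B P)
any-list≤? zero    P? = map′ (λ p → [] , z≤n , p) (λ { ([] , _ , p) → p }) (P? [])
any-list≤? (suc B) {P} P? = map′ to from (P? [] ⊎-dec Fin.any? (λ x → any-list≤? B (λ xs → P? (x ∷ xs))))
  where
  to : P [] ⊎ ∃ (λ x → ShortWitness B (λ xs → P (x ∷ xs))) → ShortWitness (suc B) P
  to (inj₁ p)                = [] , z≤n , p
  to (inj₂ (x , xs , l , p)) = x ∷ xs , s≤s l , p
  from : ShortWitness (suc B) P → P [] ⊎ ∃ (λ x → ShortWitness B (λ xs → P (x ∷ xs)))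
  from ([]     , _     , p) = inj₁ p
  from (x ∷ xs , s≤s l , p) = inj₂ (x , xs , l , p)

-- Truncated distances

module _ {n : ℕ} (G : Graph n) where

  Adj : Fin n → Fin n → Set
  Adj u v = adj G u v ≡ true

  -- A record rather than `within G k u v ≡ true`, so that k, u and v can be inferred.
  record Within (k : ℕ) (u v : Fin n) : Set where
    constructor within✓
    field holds : within G k u v ≡ true
  open Within public

  adj-sym : ∀ {u v} → Adj u v → Adj v u
  adj-sym {u} {v} a = trans (Graph.sym G v u) a

  adj⇒≢ : ∀ {u v} → Adj u v → u ≢ v
  adj⇒≢ {u} a refl with trans (sym (Graph.irrefl G u)) a
  ... | ()

  Within? : ∀ k u v → Dec (Within k u v)
  Within? k u v = map′ within✓ holds (within G k u v Bool.≟ true)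

  Within-0⇒≡ : ∀ {u v} → Within 0 u v → u ≡ v
  Within-0⇒≡ (within✓ e) = toWitness (Equivalence.from T-≡ e)

  Within-refl : ∀ u → Within 0 u u
  Within-refl u = within✓ (trans (isYes≗does (u Fin.≟ u)) (dec-true (u Fin.≟ u) refl))

  Within-suc : ∀ {k u v} → Within k u v → Within (suc k) u v
  Within-suc {k} {u} {v} (within✓ e) =
    within✓ (cong (_∨ any (λ w → adj G u w ∧ within G k w v) (allFin n)) e)

  Within-step : ∀ {k u w v} → Adj u w → Within k w v → Within (suc k) u v
  Within-step {k} {u} {w} {v} a (within✓ e) = within✓ (trans
    (cong (within G k u v ∨_) (any-≡true⁺ _ (∈-allFin w) (cong₂ _∧_ a e)))
    (∨-zeroʳ (within G k u v)))

  Within-suc⁻ : ∀ {k u v} → Within (suc k) u v → Within k u v ⊎ ∃ λ w → Adj u w × Within k w v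
  Within-suc⁻ {k} {u} {v} (within✓ e) with ∨-≡true⁻ (within G k u v) e
  ... | inj₁ e′ = inj₁ (within✓ e′)
  ... | inj₂ e′ with any-≡true⁻ _ (allFin n) e′
  ... | w , e″ = inj₂ (w , ∧-conicalˡ _ _ e″ , within✓ (∧-conicalʳ _ _ e″))

  Within-mono : ∀ {j k u v} → j ≤ k → Within j u v → Within k u v
  Within-mono j≤k = go (≤⇒≤′ j≤k)
    where
    go : ∀ {j k u v} → j ≤′ k → Within j u v → Within k u v
    go ≤′-refl        e = e
    go (≤′-step j≤′k) e = Within-suc (go j≤′k e)

  Within-trans : ∀ {j k u w v} → Within j u w → Within k w v → Within (j + k) u v
  Within-trans {zero}  e₁ e₂ rewrite Within-0⇒≡ e₁ = e₂
  Within-trans {suc j} e₁ e₂ with Within-suc⁻ e₁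
  ... | inj₁ e           = Within-suc (Within-trans e e₂)
  ... | inj₂ (x , a , e) = Within-step a (Within-trans e e₂)

  Within-adj : ∀ {u v} → Adj u v → Within 1 u v
  Within-adj {v = v} a = Within-step a (Within-refl v)

  Within-sym : ∀ {k u v} → Within k u v → Within k v u
  Within-sym {zero}  e rewrite Within-0⇒≡ e = Within-refl _
  Within-sym {suc k} {u} {v} e with Within-suc⁻ e
  ... | inj₁ e′           = Within-suc (Within-sym e′)
  ... | inj₂ (w , a , e′) = subst (λ j → Within j v u) (+-comm k 1)
                              (Within-trans (Within-sym e′) (Within-adj (adj-sym a)))

  -- Defs keeps the search behind distR private.  The metavariable `search` is solved with it
  -- by unification, `with 0` generalising the literal so that the constraint is a pattern.
  private
    mutual
      search : Fin n → Fin n → ℕ → ℕ → ℕ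
      search = _

      distR≡search : ∀ r u v → distR G r u v ≡ search u v 0 r
      distR≡search r u v with 0
      ... | _ = refl

    search≤ : ∀ u v i f → search u v i f ≤ suc (f + i)
    search≤ u v i zero with within G i u v
    ... | true  = n≤1+n i
    ... | false = ≤-refl
    search≤ u v i (suc f) with within G i u v
    ... | true  = m≤n⇒m≤1+n (m≤n+m i (suc f))
    ... | false = subst (λ j → search u v (suc i) f ≤ suc j) (+-suc f i) (search≤ u v (suc i) f)

    search-Within : ∀ u v i f → search u v i f ≤ f + i → Within (search u v i f) u v
    search-Within u v i zero le with within G i u v in eq
    ... | true  = within✓ eq
    ... | false = contradiction le 1+n≰n
    search-Within u v i (suc f) le with within G i u v in eq
    ... | true  = within✓ eq
    ... | false = search-Within u v (suc i) f (subst (search u v (suc i) f ≤_) (sym (+-suc f i)) le)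

    search-minimal : ∀ u v i f {j} → i ≤ j → j ≤ f + i → Within j u v → search u v i f ≤ j
    search-minimal u v i zero i≤j j≤i (within✓ e) with within G i u v in eq
    ... | true  = i≤j
    ... | false with refl ← ≤-antisym j≤i i≤j = contradiction (trans (sym e) eq) λ ()
    search-minimal u v i (suc f) {j} i≤j j≤f+i w@(within✓ e) with within G i u v in eq
    ... | true  = i≤j
    ... | false with m≤n⇒m<n∨m≡n i≤j
    ... | inj₂ refl = contradiction (trans (sym e) eq) λ ()
    ... | inj₁ i<j  = search-minimal u v (suc i) f i<j (subst (j ≤_) (sym (+-suc f i)) j≤f+i) w

  distR≤1+r : ∀ r u v → distR G r u v ≤ suc r
  distR≤1+r r u v = subst₂ _≤_ (sym (distR≡search r u v)) (cong suc (+-identityʳ r)) (search≤ u v 0 r)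

  distR-Within : ∀ {r u v} → distR G r u v ≤ r → Within (distR G r u v) u v
  distR-Within {r} {u} {v} le rewrite distR≡search r u v =
    search-Within u v 0 r (subst (search u v 0 r ≤_) (sym (+-identityʳ r)) le)

  distR-minimal : ∀ {r u v j} → j ≤ r → Within j u v → distR G r u v ≤ j
  distR-minimal {r} {u} {v} {j} j≤r w rewrite distR≡search r u v =
    search-minimal u v 0 r z≤n (subst (j ≤_) (sym (+-identityʳ r)) j≤r) w

  Within-distR : ∀ {r u v j} → j ≤ r → distR G r u v ≤ j → Within j u v
  Within-distR j≤r le = Within-mono le (distR-Within (≤-trans le j≤r))

  distR-char : ∀ r u v d → (∀ {j} → j ≤ r → Within j u v → d ≤ j) →
               (∀ {j} → j ≤ r → d ≤ j → Within j u v) → distR G r u v ≡ d ⊓ suc r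
  distR-char r u v d lower upper with d ≤? r
  ... | yes d≤r = begin
    distR G r u v ≡⟨ ≤-antisym distR≤d (lower distR≤r (distR-Within distR≤r)) ⟩
    d             ≡⟨ m≤n⇒m⊓n≡m (m≤n⇒m≤1+n d≤r) ⟨
    d ⊓ suc r     ∎
    where
    open ≡-Reasoning
    distR≤d : distR G r u v ≤ d
    distR≤d = distR-minimal d≤r (upper d≤r ≤-refl)
    distR≤r : distR G r u v ≤ r
    distR≤r = ≤-trans distR≤d d≤r
  ... | no d≰r = begin
    distR G r u v ≡⟨ ≤-antisym (distR≤1+r r u v) 1+r≤distR ⟩
    suc r         ≡⟨ m≥n⇒m⊓n≡n (≰⇒> d≰r) ⟨
    d ⊓ suc r     ∎
    where
    open ≡-Reasoning
    1+r≤distR : suc r ≤ distR G r u v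
    1+r≤distR with distR G r u v ≤? r
    ... | no  ≰r = ≰⇒> ≰r
    ... | yes ≤r = contradiction (≤-trans (lower ≤r (distR-Within ≤r)) ≤r) d≰r

module _ {n : ℕ} (G H : Graph n) where

  distR-mono : (∀ {k u v} → Within H k u v → Within G k u v) →
               ∀ r u v → distR G r u v ≤ distR H r u v
  distR-mono H⇒G r u v with distR H r u v ≤? r
  ... | yes ≤r = distR-minimal G ≤r (H⇒G (distR-Within H ≤r))
  ... | no  ≰r = ≤-trans (distR≤1+r G r u v) (≰⇒> ≰r)

module _ {n : ℕ} (G : Graph n) where

  edgeOf : ∀ p q → Adj G p q → Elem G
  edgeOf p q a with toℕ p <? toℕ q
  ... | yes p<q = edge p q p<q a
  ... | no  p≮q =
    edge q p (≤∧≢⇒< (≮⇒≥ p≮q) (λ e → adj⇒≢ G a (sym (Fin.toℕ-injective e)))) (adj-sym G a)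

  distRE-edgeOf : ∀ r p q a v → distRE G r (edgeOf p q a) v ≡ distR G r p v ⊓ distR G r q v
  distRE-edgeOf r p q a v with toℕ p <? toℕ q
  ... | yes _ = refl
  ... | no  _ = ⊓-comm (distR G r q v) (distR G r p v)

  edge-≡ : ∀ {u u′ w w′} {p : toℕ u < toℕ w} {p′ : toℕ u′ < toℕ w′}
             {a : Adj G u w} {a′ : Adj G u′ w′} →
           u ≡ u′ → w ≡ w′ → edge {G = G} u w p a ≡ edge u′ w′ p′ a′
  edge-≡ refl refl = cong₂ (edge _ _) (<-irrelevant _ _) (Decidable⇒UIP.≡-irrelevant Bool._≟_ _ _)

  key : Elem G → Fin n ⊎ (Fin n × Fin n)
  key (vert x)       = inj₁ x
  key (edge u w _ _) = inj₂ (u , w)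

  key-injective : ∀ a b → key a ≡ key b → a ≡ b
  key-injective (vert x)       (vert .x)        refl = refl
  key-injective (edge u w _ _) (edge .u .w _ _) refl = edge-≡ refl refl

  _≟ᴱ_ : DecidableEquality (Elem G)
  a ≟ᴱ b = map′ (key-injective a b) (cong key)
                (⊎.≡-dec Fin._≟_ (×.≡-dec Fin._≟_ Fin._≟_) (key a) (key b))

  vert≢edgeOf : ∀ x p q a → vert x ≢ edgeOf p q a
  vert≢edgeOf x p q a with toℕ p <? toℕ q
  ... | yes _ = λ ()
  ... | no  _ = λ ()

-- Rooted trees and the lower bound

module Rooted {n : ℕ} (G : Graph n) (connected : Connected G) (ρ : Fin n) where

  private
    depth-spec : ∀ x → ∃ λ d → Within G d x ρ × (∀ j → Within G j x ρ → d ≤ j)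
    depth-spec x =
      least (λ k → Within? G k x ρ) {proj₁ (connected x ρ)} (within✓ (proj₂ (connected x ρ)))

  depth : Fin n → ℕ
  depth x = proj₁ (depth-spec x)

  depth-Within : ∀ x → Within G (depth x) x ρ
  depth-Within x = proj₁ (proj₂ (depth-spec x))

  depth-minimal : ∀ {j} x → Within G j x ρ → depth x ≤ j
  depth-minimal x = proj₂ (proj₂ (depth-spec x)) _

  depth-adj : ∀ {x y} → Adj G x y → depth x ≤ suc (depth y)
  depth-adj {x} {y} a = depth-minimal x (Within-step G a (depth-Within y))

  depth≡0⇒≡root : ∀ {x} → depth x ≡ 0 → x ≡ ρ
  depth≡0⇒≡root {x} e = Within-0⇒≡ G (subst (λ d → Within G d x ρ) e (depth-Within x))

  lower-neighbour : ∀ {x h} → depth x ≡ suc h → ∃ λ y → Adj G x y × depth y ≡ h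
  lower-neighbour {x} {h} e with Within-suc⁻ G (subst (λ d → Within G d x ρ) e (depth-Within x))
  ... | inj₁ w = contradiction (subst (_≤ h) e (depth-minimal x w)) 1+n≰n
  ... | inj₂ (y , a , w) =
    y , a , ≤-antisym (depth-minimal y w) (s≤s⁻¹ (subst (_≤ suc (depth y)) e (depth-adj a)))

  private
    parentAt : ∀ x d → depth x ≡ d → Fin n
    parentAt x zero    _ = x
    parentAt x (suc h) e = proj₁ (lower-neighbour e)

  parent : Fin n → Fin n
  parent x = parentAt x (depth x) refl

  parent-spec : ∀ {x} → 0 < depth x → Adj G x (parent x) × suc (depth (parent x)) ≡ depth x
  parent-spec {x} = go (depth x) refl
    where
    go : ∀ d (e : depth x ≡ d) → 0 < d →
         Adj G x (parentAt x d e) × suc (depth (parentAt x d e)) ≡ depth x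
    go (suc h) e _ = map₂ (λ e′ → trans (cong suc e′) (sym e)) (proj₂ (lower-neighbour e))

  ancestor : ℕ → Fin n → Fin n
  ancestor zero    x = x
  ancestor (suc i) x = parent (ancestor i x)

  depth-ancestor : ∀ x {i} → i ≤ depth x → depth (ancestor i x) + i ≡ depth x
  depth-ancestor x {zero}  _   = +-identityʳ (depth x)
  depth-ancestor x {suc i} i<d = begin
    depth (parent y) + suc i   ≡⟨ +-suc (depth (parent y)) i ⟩
    suc (depth (parent y)) + i ≡⟨ cong (_+ i) (proj₂ (parent-spec 0<depth-y)) ⟩
    depth y + i                ≡⟨ e ⟩
    depth x                    ∎
    where
    open ≡-Reasoning
    y : Fin n
    y = ancestor i x
    e : depth y + i ≡ depth x
    e = depth-ancestor x (<⇒≤ i<d)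
    0<depth-y : 0 < depth y
    0<depth-y = +-cancelʳ-< i 0 (depth y) (subst (i <_) (sym e) i<d)

  depth<n : ∀ x → depth x < n
  depth<n x = Fin.injective⇒≤ ancestors-injective
    where
    toℕ≤depth : (a : Fin (suc (depth x))) → toℕ a ≤ depth x
    toℕ≤depth a = s≤s⁻¹ (Fin.toℕ<n a)
    ancestors-injective : ∀ {a b} → ancestor (toℕ a) x ≡ ancestor (toℕ b) x → a ≡ b
    ancestors-injective {a} {b} e = Fin.toℕ-injective (+-cancelˡ-≡ (depth (ancestor (toℕ a) x)) _ _ (begin
      depth (ancestor (toℕ a) x) + toℕ a ≡⟨ depth-ancestor x (toℕ≤depth a) ⟩
      depth x                            ≡⟨ depth-ancestor x (toℕ≤depth b) ⟨
      depth (ancestor (toℕ b) x) + toℕ b ≡⟨ cong (λ y → depth y + toℕ b) e ⟨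
      depth (ancestor (toℕ a) x) + toℕ b ∎))
      where open ≡-Reasoning

module Tree {n : ℕ} (G : Graph n) (tree : IsTree G) (ρ : Fin n) where

  open Rooted G (proj₁ tree) ρ public

  private
    parent-below : ∀ {x h} → depth x ≡ suc h → Adj G x (parent x) × depth (parent x) ≡ h
    parent-below {x} e with parent-spec (subst (0 <_) (sym e) z<s)
    ... | x~px , e′ = x~px , suc-injective (trans e′ e)

    below⇒≢ : ∀ {h x y} → depth x ≤ h → depth y ≡ suc h → x ≢ y
    below⇒≢ x≤h e refl = 1+n≰n (subst (_≤ _) e x≤h)

  record PathBelow (a b : Fin n) (h : ℕ) : Set where
    field
      rest   : List (Fin n)
      walk   : WalkFrom G a rest b
      unique : Unique (a ∷ rest)
      below  : All (λ x → depth x ≤ h) (a ∷ rest)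
      long   : 2 ≤ length rest

  walk-snoc : ∀ {x ys y z} → WalkFrom G x ys y → Adj G y z → WalkFrom G x (ys ++ [ z ]) z
  walk-snoc stop       a = step a stop
  walk-snoc (step b w) a = step b (walk-snoc w a)

  unique-snoc : ∀ {xs : List (Fin n)} {z} → Unique xs → All (_≢ z) xs → Unique (xs ++ [ z ])
  unique-snoc u ≢z = AllPairs.++⁺ u ([] ∷ []) (All.map (_∷ []) ≢z)

  -- Climb from a and from b in parallel until the two branches meet.
  path-within-level : ∀ h {a b} → a ≢ b → depth a ≡ h → depth b ≡ h → PathBelow a b h
  path-within-level zero a≢b ea eb =
    contradiction (trans (depth≡0⇒≡root ea) (sym (depth≡0⇒≡root eb))) a≢b
  path-within-level (suc h) {a} {b} a≢b ea eb with parent-below ea | parent-below eb | parent a Fin.≟ parent b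
  ... | a~pa , pa-h | b~pb , pb-h | yes pa≡pb = record
    { rest   = parent a ∷ b ∷ []
    ; walk   = step a~pa (step (subst (λ x → Adj G x b) (sym pa≡pb) (adj-sym G b~pb)) stop)
    ; unique = (≢-sym (below⇒≢ (≤-reflexive pa-h) ea) ∷ a≢b ∷ [])
               ∷ (below⇒≢ (≤-reflexive pa-h) eb ∷ []) ∷ [] ∷ []
    ; below  = ≤-reflexive ea ∷ m≤n⇒m≤1+n (≤-reflexive pa-h) ∷ ≤-reflexive eb ∷ []
    ; long   = s≤s (s≤s z≤n)
    }
  ... | a~pa , pa-h | b~pb , pb-h | no pa≢pb = record
    { rest   = parent a ∷ rest ++ [ b ]
    ; walk   = step a~pa (walk-snoc walk (adj-sym G b~pb))
    ; unique = All.++⁺ (All.map (λ le → ≢-sym (below⇒≢ le ea)) below) (a≢b ∷ [])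
               ∷ unique-snoc unique (All.map (λ le → below⇒≢ le eb) below)
    ; below  = ≤-reflexive ea ∷ All.++⁺ (All.map m≤n⇒m≤1+n below) (≤-reflexive eb ∷ [])
    ; long   = ≤-trans long (≤-trans (length-++-≤ˡ rest) (n≤1+n _))
    }
    where open PathBelow (path-within-level h pa≢pb pa-h pb-h)

  PathBelow-cons : ∀ {x a b h} → Adj G x a → depth x ≡ suc h → PathBelow a b h → PathBelow x b (suc h)
  PathBelow-cons x~a ex P = record
    { rest   = _ ∷ rest
    ; walk   = step x~a walk
    ; unique = All.map (λ le → ≢-sym (below⇒≢ le ex)) below ∷ unique
    ; below  = ≤-reflexive ex ∷ All.map m≤n⇒m≤1+n below
    ; long   = ≤-trans long (n≤1+n _)
    }
    where open PathBelow P

  PathBelow-unclosable : ∀ {a b h} → PathBelow a b h → ¬ Adj G b a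
  PathBelow-unclosable {a} {b} P b~a = proj₂ tree record
    { start = a ; rest = rest ; end = b ; walk = walk ; long = long ; closed = b~a ; unique = unique }
    where open PathBelow P

  adjacent-depth≢ : ∀ {a b} → Adj G a b → depth a ≢ depth b
  adjacent-depth≢ a~b e =
    PathBelow-unclosable (path-within-level _ (adj⇒≢ G a~b) refl (sym e)) (adj-sym G a~b)

  lower-neighbour-unique : ∀ {x w₁ w₂ h} → Adj G x w₁ → Adj G x w₂ →
                           depth w₁ ≡ h → depth w₂ ≡ h → depth x ≡ suc h → w₁ ≡ w₂
  lower-neighbour-unique {w₁ = w₁} {w₂} x~w₁ x~w₂ e₁ e₂ ex with w₁ Fin.≟ w₂
  ... | yes w₁≡w₂ = w₁≡w₂
  ... | no  w₁≢w₂ = contradiction (adj-sym G x~w₂)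
    (PathBelow-unclosable (PathBelow-cons x~w₁ ex (path-within-level _ w₁≢w₂ e₁ e₂)))

  neighbour-is-child : ∀ {p x} → 0 < depth p → Adj G p x → x ≢ parent p →
                       parent x ≡ p × depth x ≡ suc (depth p)
  neighbour-is-child {p} {x} 0<p p~x x≢pp with parent-spec 0<p | <-cmp (depth x) (depth p)
  ... | p~pp , e | tri< x<p _ _ = contradiction (lower-neighbour-unique p~x p~pp x≡pp refl (sym e)) x≢pp
    where
    x≡pp : depth x ≡ depth (parent p)
    x≡pp = ≤-antisym (s≤s⁻¹ (subst (depth x <_) (sym e) x<p))
                     (s≤s⁻¹ (subst (_≤ suc (depth x)) (sym e) (depth-adj p~x)))
  ... | _ | tri≈ _ x≡p _ = contradiction (sym x≡p) (adjacent-depth≢ p~x)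
  ... | _ | tri> _ _ p<x with x≡1+p ← ≤-antisym (depth-adj (adj-sym G p~x)) p<x | parent-below x≡1+p
  ... | x~px , px≡p = lower-neighbour-unique x~px (adj-sym G p~x) px≡p refl x≡1+p , x≡1+p

  -- A walk of length e from p to v that avoids parent(p) first steps down to a child of p.
  ancestor-reaches : ∀ e {p v} → 0 < depth p → Within G e p v → ¬ Within G e (parent p) v →
                     ancestor e v ≡ p
  ancestor-reaches zero    _   reach _ = sym (Within-0⇒≡ G reach)
  ancestor-reaches (suc e) {p} {v} 0<p reach miss with Within-suc⁻ G reach
  ... | inj₁ reach′ = contradiction (Within-step G pp~p reach′) miss
    where
    pp~p : Adj G (parent p) p
    pp~p = adj-sym G (proj₁ (parent-spec 0<p))
  ... | inj₂ (x , p~x , reach′) with x Fin.≟ parent p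
  ... | yes refl = contradiction (Within-suc G reach′) miss
  ... | no x≢pp with neighbour-is-child 0<p p~x x≢pp
  ... | px≡p , x≡1+p = trans (cong parent (ancestor-reaches e 0<x reach′ miss′)) px≡p
    where
    0<x : 0 < depth x
    0<x = subst (0 <_) (sym x≡1+p) z<s
    miss′ : ¬ Within G e (parent x) v
    miss′ w = miss (Within-step G (adj-sym G (proj₁ (parent-spec 0<p)))
                                  (subst (λ y → Within G e y v) px≡p w))

  record Separator (r : ℕ) (S : Subset n) (p : Fin n) : Set where
    field
      landmark   : Fin n
      landmark∈S : landmark ∈ S
      reach      : Fin (suc r)
      reaches    : Within G (toℕ reach) p landmark
      misses     : ¬ Within G (toℕ reach) (parent p) landmark

  separator : ∀ {r S p} → IsMixedResolving G r S → 0 < depth p → Separator r S p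
  separator {r} {S} {p} resolving 0<p =
    build (resolving (vert (parent p)) (edgeOf G p (parent p) p~pp) (vert≢edgeOf G _ _ _ p~pp))
    where
    p~pp : Adj G p (parent p)
    p~pp = proj₁ (parent-spec 0<p)
    build : (∃ λ v → v ∈ S × distRE G r (vert (parent p)) v ≢ distRE G r (edgeOf G p (parent p) p~pp) v) →
            Separator r S p
    build (v , v∈S , ≢) = record
      { landmark   = v
      ; landmark∈S = v∈S
      ; reach      = Fin.fromℕ< (s≤s d≤r)
      ; reaches    = subst (λ j → Within G j p v) (sym (Fin.toℕ-fromℕ< _)) (Within-distR G d≤r ≤-refl)
      ; misses     = λ w → <⇒≱ d<d′
          (distR-minimal G d≤r (subst (λ j → Within G j (parent p) v) (Fin.toℕ-fromℕ< _) w))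
      }
      where
      d<d′ : distR G r p v < distR G r (parent p) v
      d<d′ with distR G r p v <? distR G r (parent p) v
      ... | yes lt = lt
      ... | no  ≮  = contradiction
        (trans (sym (m≥n⇒m⊓n≡n (≮⇒≥ ≮))) (sym (distRE-edgeOf G r p (parent p) p~pp v))) ≢
      d≤r : distR G r p v ≤ r
      d≤r = s≤s⁻¹ (≤-trans d<d′ (distR≤1+r G r (parent p) v))

  separator-ancestor : ∀ {r S p} → 0 < depth p → (s : Separator r S p) →
                       ancestor (toℕ (Separator.reach s)) (Separator.landmark s) ≡ p
  separator-ancestor 0<p s = ancestor-reaches _ 0<p (Separator.reaches s) (Separator.misses s)

tree-order-bound : ∀ {n} (T : Graph (suc n)) → IsTree T →
                   ∀ {r S} → IsMixedResolving T r S → n ≤ ∣ S ∣ * suc r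
tree-order-bound {n} T tree {r} {S} resolving = Fin.injective⇒≤ code-injective
  where
  open Tree T tree Fin.zero
  open Separator

  non-root : ∀ i → 0 < depth (Fin.suc i)
  non-root i = n≢0⇒n>0 (λ e → Fin.0≢1+n (sym (depth≡0⇒≡root e)))

  sep : ∀ i → Separator r S (Fin.suc i)
  sep i = separator resolving (non-root i)

  code : Fin n → Fin (∣ S ∣ * suc r)
  code i = Fin.combine (rank S (landmark∈S (sep i))) (reach (sep i))

  code-injective : ∀ {i j} → code i ≡ code j → i ≡ j
  code-injective {i} {j} e with combine-injective e
  ... | rank≡ , reach≡ = Fin.suc-injective (begin
    Fin.suc i                                        ≡⟨ separator-ancestor (non-root i) (sep i) ⟨
    ancestor (toℕ (reach (sep i))) (landmark (sep i))
      ≡⟨ cong₂ (λ k v → ancestor (toℕ k) v) reach≡ landmark≡ ⟩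
    ancestor (toℕ (reach (sep j))) (landmark (sep j)) ≡⟨ separator-ancestor (non-root j) (sep j) ⟩
    Fin.suc j                                        ∎)
    where
    open ≡-Reasoning
    landmark≡ : landmark (sep i) ≡ landmark (sep j)
    landmark≡ = rank-injective S (landmark∈S (sep i)) (landmark∈S (sep j)) rank≡

-- Paths and their landmarks

∣n-1+n∣≡1 : ∀ n → ∣ n - suc n ∣ ≡ 1
∣n-1+n∣≡1 zero    = refl
∣n-1+n∣≡1 (suc n) = ∣n-1+n∣≡1 n

∣m-n∣≡1⇒ : ∀ m n → ∣ m - n ∣ ≡ 1 → suc m ≡ n ⊎ suc n ≡ m
∣m-n∣≡1⇒ zero          (suc zero)    _ = inj₁ refl
∣m-n∣≡1⇒ (suc zero)    zero          _ = inj₂ refl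
∣m-n∣≡1⇒ (suc m)       (suc n)       e = Sum.map (cong suc) (cong suc) (∣m-n∣≡1⇒ m n e)
∣m-n∣≡1⇒ zero          zero          ()
∣m-n∣≡1⇒ zero          (suc (suc n)) ()
∣m-n∣≡1⇒ (suc (suc m)) zero          ()

path : (n : ℕ) → Graph n
path n = record
  { adj    = λ u v → ⌊ ∣ toℕ u - toℕ v ∣ ≟ 1 ⌋
  ; sym    = λ u v → cong (λ d → ⌊ d ≟ 1 ⌋) (∣-∣-comm (toℕ u) (toℕ v))
  ; irrefl = λ u → cong (λ d → ⌊ d ≟ 1 ⌋) (∣n-n∣≡0 (toℕ u))
  }

module _ {n : ℕ} where

  path-adj⁻ : ∀ {u v : Fin n} → Adj (path n) u v → ∣ toℕ u - toℕ v ∣ ≡ 1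
  path-adj⁻ a = toWitness (Equivalence.from T-≡ a)

  path-adj⁺ : ∀ {u v : Fin n} → ∣ toℕ u - toℕ v ∣ ≡ 1 → Adj (path n) u v
  path-adj⁺ {u} {v} e = trans (isYes≗does (∣ toℕ u - toℕ v ∣ ≟ 1)) (dec-true (∣ toℕ u - toℕ v ∣ ≟ 1) e)

  Within-path⁻ : ∀ {k} {u v : Fin n} → Within (path n) k u v → ∣ toℕ u - toℕ v ∣ ≤ k
  Within-path⁻ {zero} {u} w =
    ≤-reflexive (trans (cong (λ y → ∣ toℕ u - toℕ y ∣) (sym (Within-0⇒≡ (path n) w))) (∣n-n∣≡0 (toℕ u)))
  Within-path⁻ {suc k} {u} {v} w with Within-suc⁻ (path n) w
  ... | inj₁ w′ = m≤n⇒m≤1+n (Within-path⁻ w′)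
  ... | inj₂ (x , a , w′) = begin
    ∣ toℕ u - toℕ v ∣                     ≤⟨ ∣-∣-triangle (toℕ u) (toℕ x) (toℕ v) ⟩
    ∣ toℕ u - toℕ x ∣ + ∣ toℕ x - toℕ v ∣ ≡⟨ cong (_+ ∣ toℕ x - toℕ v ∣) (path-adj⁻ {u} {x} a) ⟩
    suc ∣ toℕ x - toℕ v ∣                 ≤⟨ s≤s (Within-path⁻ w′) ⟩
    suc k                                 ∎
    where open ≤-Reasoning

  Within-path-ascending : ∀ d {u v : Fin n} → toℕ v ≡ toℕ u + d → Within (path n) d u v
  Within-path-ascending zero {u} {v} e =
    subst (Within (path n) 0 u) (Fin.toℕ-injective (trans (sym (+-identityʳ (toℕ u))) (sym e)))
          (Within-refl (path n) u)
  Within-path-ascending (suc d) {u} {v} e =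
    Within-step (path n)
                (path-adj⁺ {u} {w} (subst (λ j → ∣ toℕ u - j ∣ ≡ 1) (sym toℕw) (∣n-1+n∣≡1 (toℕ u))))
                (Within-path-ascending d (trans e (trans (+-suc (toℕ u) d) (cong (_+ d) (sym toℕw)))))
    where
    1+u<n : suc (toℕ u) < n
    1+u<n = ≤-<-trans (subst (suc (toℕ u) ≤_) (sym (+-suc (toℕ u) d)) (s≤s (m≤m+n (toℕ u) d)))
                      (subst (_< n) e (Fin.toℕ<n v))
    w : Fin n
    w = Fin.fromℕ< 1+u<n
    toℕw : toℕ w ≡ suc (toℕ u)
    toℕw = Fin.toℕ-fromℕ< 1+u<n

  Within-path⁺ : ∀ {k} {u v : Fin n} → ∣ toℕ u - toℕ v ∣ ≤ k → Within (path n) k u v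
  Within-path⁺ {k} {u} {v} le with ≤-total (toℕ u) (toℕ v)
  ... | inj₁ u≤v = Within-mono (path n) (subst (_≤ k) (m≤n⇒∣m-n∣≡n∸m u≤v) le)
                     (Within-path-ascending _ (sym (m+[n∸m]≡n u≤v)))
  ... | inj₂ v≤u = Within-sym (path n) (Within-mono (path n) (subst (_≤ k) (m≤n⇒∣n-m∣≡n∸m v≤u) le)
                     (Within-path-ascending _ (sym (m+[n∸m]≡n v≤u))))

  distR-path : ∀ r (u v : Fin n) → distR (path n) r u v ≡ ∣ toℕ u - toℕ v ∣ ⊓ suc r
  distR-path r u v = distR-char (path n) r u v _ (λ _ → Within-path⁻) (λ _ → Within-path⁺)

  distR-path-below : ∀ r {x v : Fin n} → toℕ v ≤ toℕ x → distR (path n) r x v ≡ (toℕ x ∸ toℕ v) ⊓ suc r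
  distR-path-below r {x} {v} v≤x = trans (distR-path r x v) (cong (_⊓ suc r) (m≤n⇒∣n-m∣≡n∸m v≤x))

  distR-path-above : ∀ r {x v : Fin n} → toℕ x ≤ toℕ v → distR (path n) r x v ≡ (toℕ v ∸ toℕ x) ⊓ suc r
  distR-path-above r {x} {v} x≤v = trans (distR-path r x v) (cong (_⊓ suc r) (m≤n⇒∣m-n∣≡n∸m x≤v))

  path-connected : Connected (path n)
  path-connected u v = ∣ toℕ u - toℕ v ∣ , holds (Within-path⁺ {u = u} {v} ≤-refl)

  private
    path-step : ∀ {u v : Fin n} → Adj (path n) u v → suc (toℕ u) ≡ toℕ v ⊎ suc (toℕ v) ≡ toℕ u
    path-step {u} {v} a = ∣m-n∣≡1⇒ (toℕ u) (toℕ v) (path-adj⁻ {u} {v} a)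

    path-adj-offset : ∀ {x y : Fin n} {k} → toℕ y ≡ toℕ x + suc k → Adj (path n) x y → k ≡ 0
    path-adj-offset {x} {y} {k} e a = suc-injective (begin
      suc k                           ≡⟨ ∣m-m+n∣≡n (toℕ x) (suc k) ⟨
      ∣ toℕ x - toℕ x + suc k ∣       ≡⟨ cong (λ j → ∣ toℕ x - j ∣) e ⟨
      ∣ toℕ x - toℕ y ∣               ≡⟨ path-adj⁻ {x} {y} a ⟩
      1                               ∎)
      where open ≡-Reasoning

  walk-ascending : ∀ {u w xs v} → suc (toℕ u) ≡ toℕ w → WalkFrom (path n) w xs v → Unique (u ∷ w ∷ xs) →
                   toℕ v ≡ toℕ u + suc (length xs)
  walk-ascending {u} e stop _ = trans (sym e) (+-comm 1 (toℕ u))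
  walk-ascending {u} e (step {w = w′} {vs = xs′} a walk) ((_ ∷ u≢w′ ∷ _) ∷ unique) with path-step a
  ... | inj₂ down = contradiction (Fin.toℕ-injective (suc-injective (trans e (sym down)))) u≢w′
  ... | inj₁ up = begin
    _                                 ≡⟨ walk-ascending up walk unique ⟩
    toℕ _ + suc (length xs′)          ≡⟨ cong (_+ suc (length xs′)) e ⟨
    suc (toℕ u) + suc (length xs′)    ≡⟨ +-suc (toℕ u) (suc (length xs′)) ⟨
    toℕ u + suc (suc (length xs′))    ∎
    where open ≡-Reasoning

  walk-descending : ∀ {u w xs v} → suc (toℕ w) ≡ toℕ u → WalkFrom (path n) w xs v → Unique (u ∷ w ∷ xs) →
                    toℕ u ≡ toℕ v + suc (length xs)
  walk-descending {u} {w} e stop _ = trans (sym e) (+-comm 1 (toℕ w))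
  walk-descending {u} e (step {w = w′} {vs = xs′} a walk) ((_ ∷ u≢w′ ∷ _) ∷ unique) with path-step a
  ... | inj₁ up = contradiction (Fin.toℕ-injective (trans (sym e) up)) u≢w′
  ... | inj₂ down = begin
    toℕ u                             ≡⟨ e ⟨
    suc (toℕ _)                       ≡⟨ cong suc (walk-descending down walk unique) ⟩
    suc (toℕ _ + suc (length xs′))    ≡⟨ +-suc _ (suc (length xs′)) ⟨
    toℕ _ + suc (suc (length xs′))    ∎
    where open ≡-Reasoning

  path-acyclic : Acyclic (path n)
  path-acyclic c = no-closing (Cycle.walk c) (Cycle.long c) (Cycle.closed c) (Cycle.unique c)
    where
    long⇒≢0 : ∀ {l} → 2 ≤ suc l → l ≢ 0
    long⇒≢0 (s≤s ()) refl
    no-closing : ∀ {s xs e} → WalkFrom (path n) s xs e → 2 ≤ length xs → Adj (path n) e s →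
                 Unique (s ∷ xs) → ⊥
    no-closing {s} {e = e} (step a walk) long closed unique with path-step a
    ... | inj₁ up   = long⇒≢0 long
      (path-adj-offset {s} {e} (walk-ascending up walk unique) (adj-sym (path n) {e} {s} closed))
    ... | inj₂ down = long⇒≢0 long (path-adj-offset {e} {s} (walk-descending down walk unique) closed)

  edge-high : ∀ {u w : Fin n} → toℕ u < toℕ w → Adj (path n) u w → toℕ w ≡ suc (toℕ u)
  edge-high {u} {w} u<w a with path-step a
  ... | inj₁ up   = sym up
  ... | inj₂ down = contradiction (≤-reflexive down) (<-asym u<w)

  low high : Elem (path n) → ℕ
  low  (vert x)       = toℕ x
  low  (edge u _ _ _) = toℕ u
  high (vert x)       = toℕ x
  high (edge _ w _ _) = toℕ w

  low<n : ∀ a → low a < n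
  low<n (vert x)       = Fin.toℕ<n x
  low<n (edge u _ _ _) = Fin.toℕ<n u

  distRE-below : ∀ r a (v : Fin n) → toℕ v ≤ low a → distRE (path n) r a v ≡ (low a ∸ toℕ v) ⊓ suc r
  distRE-below r (vert x) v v≤x = distR-path-below r v≤x
  distRE-below r (edge u w u<w _) v v≤u
    rewrite distR-path-below r v≤u | distR-path-below r (≤-trans v≤u (<⇒≤ u<w)) =
    m≤n⇒m⊓n≡m (⊓-monoˡ-≤ (suc r) (∸-monoˡ-≤ (toℕ v) (<⇒≤ u<w)))

  distRE-above : ∀ r a (v : Fin n) → high a ≤ toℕ v → distRE (path n) r a v ≡ (toℕ v ∸ high a) ⊓ suc r
  distRE-above r (vert x) v x≤v = distR-path-above r x≤v
  distRE-above r (edge u w u<w _) v w≤v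
    rewrite distR-path-above r (≤-trans (<⇒≤ u<w) w≤v) | distR-path-above r w≤v =
    m≥n⇒m⊓n≡n (⊓-monoˡ-≤ (suc r) (∸-monoʳ-≤ (toℕ v) (<⇒≤ u<w)))

module Landmarks (n′ L′ : ℕ) where

  private
    n L : ℕ
    n = suc n′
    L = suc L′

  IsLandmark : Fin n → Set
  IsLandmark v = toℕ v % L ≡ 0 ⊎ toℕ v ≡ n′

  isLandmark? : Decidable IsLandmark
  isLandmark? v = (toℕ v % L ≟ 0) ⊎-dec (toℕ v ≟ n′)

  landmarks : Subset n
  landmarks = tabulate (λ v → ⌊ isLandmark? v ⌋)

  private
    i<[i/L]*L+L : ∀ i → i < i / L * L + L
    i<[i/L]*L+L i = begin-strict
      i                 ≡⟨ m≡m%n+[m/n]*n i L ⟩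
      i % L + i / L * L <⟨ +-monoˡ-< (i / L * L) (m%n<n i L) ⟩
      L + i / L * L     ≡⟨ +-comm L (i / L * L) ⟩
      i / L * L + L     ∎
      where open ≤-Reasoning

  landmark-below : ∀ {i} → i < n → ∃ λ v → v ∈ landmarks × toℕ v ≤ i × i < toℕ v + L
  landmark-below {i} i<n = v , ∈-tabulate⁺ isLandmark? (inj₁ v%L≡0) ,
                           ≤-trans (≤-reflexive toℕv≡ℓ) (m/n*n≤m i L) ,
                           subst (λ j → i < j + L) (sym toℕv≡ℓ) (i<[i/L]*L+L i)
    where
    v : Fin n
    v = Fin.fromℕ< (≤-<-trans (m/n*n≤m i L) i<n)
    toℕv≡ℓ : toℕ v ≡ i / L * L
    toℕv≡ℓ = Fin.toℕ-fromℕ< _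
    v%L≡0 : toℕ v % L ≡ 0
    v%L≡0 = trans (cong (_% L) toℕv≡ℓ) (m*n%n≡0 (i / L) L)

  landmark-above : ∀ {i} → i < n′ → ∃ λ v → v ∈ landmarks × i < toℕ v × toℕ v ≤ i + L
  landmark-above {i} i<n′ with L + i / L * L <? n
  ... | yes next<n = v , ∈-tabulate⁺ isLandmark? (inj₁ v%L≡0) ,
                     subst (i <_) (trans (+-comm (i / L * L) L) (sym toℕv)) (i<[i/L]*L+L i) ,
                     ≤-trans (≤-reflexive toℕv)
                             (≤-trans (+-monoʳ-≤ L (m/n*n≤m i L)) (≤-reflexive (+-comm L i)))
    where
    v : Fin n
    v = Fin.fromℕ< next<n
    toℕv : toℕ v ≡ L + i / L * L
    toℕv = Fin.toℕ-fromℕ< next<n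
    v%L≡0 : toℕ v % L ≡ 0
    v%L≡0 = trans (cong (_% L) toℕv) (m*n%n≡0 (suc (i / L)) L)
  ... | no next≮n = Fin.fromℕ n′ , ∈-tabulate⁺ isLandmark? (inj₂ (Fin.toℕ-fromℕ n′)) ,
                    subst (i <_) (sym (Fin.toℕ-fromℕ n′)) i<n′ ,
                    ≤-trans (≤-reflexive (Fin.toℕ-fromℕ n′)) (begin
                      n′            ≤⟨ n≤1+n n′ ⟩
                      n             ≤⟨ ≮⇒≥ next≮n ⟩
                      L + i / L * L ≤⟨ +-monoʳ-≤ L (m/n*n≤m i L) ⟩
                      L + i         ≡⟨ +-comm L i ⟩
                      i + L         ∎)
    where open ≤-Reasoning

  Separated : Elem (path n) → Elem (path n) → Set
  Separated a b = ∃ λ v → v ∈ landmarks × distRE (path n) L a v ≢ distRE (path n) L b v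

  Separated-sym : ∀ a b → Separated a b → Separated b a
  Separated-sym _ _ (v , v∈ , ≢) = v , v∈ , ≢-sym ≢

  separate-by-low : ∀ a b → low a < low b → Separated a b
  separate-by-low a b a<b with landmark-below (low<n a)
  ... | v , v∈ , v≤a , a<v+L = v , v∈ , λ e → 1+n≰n (≤-trans distRE-b> (≤-reflexive (trans (sym e) distRE-a)))
    where
    a∸v<L : low a ∸ toℕ v < L
    a∸v<L = m<n+o⇒m∸n<o (low a) (toℕ v) a<v+L
    distRE-a : distRE (path n) L a v ≡ low a ∸ toℕ v
    distRE-a = trans (distRE-below L a v v≤a) (m≤n⇒m⊓n≡m (m≤n⇒m≤1+n (<⇒≤ a∸v<L)))
    distRE-b> : low a ∸ toℕ v < distRE (path n) L b v
    distRE-b> rewrite distRE-below L b v (≤-trans v≤a (<⇒≤ a<b)) =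
      ⊓-glb (∸-monoˡ-< a<b v≤a) (s≤s (<⇒≤ a∸v<L))

  separate-vertex-edge : ∀ x u w u<w a → toℕ x ≡ toℕ u → Separated (vert x) (edge u w u<w a)
  separate-vertex-edge x u w u<w a x≡u
    with landmark-above {toℕ u} (s≤s⁻¹ (subst (_< n) (edge-high u<w a) (Fin.toℕ<n w)))
  ... | v , v∈ , u<v , v≤u+L = v , v∈ , λ e → <-irrefl (trans (sym distRE-edge) (trans (sym e) distRE-vert)) gap
    where
    v∸u≤L : toℕ v ∸ toℕ u ≤ L
    v∸u≤L = m≤n+o⇒m∸n≤o (toℕ v) (toℕ u) v≤u+L
    w≤v : toℕ w ≤ toℕ v
    w≤v = ≤-trans (≤-reflexive (edge-high u<w a)) u<v
    gap : toℕ v ∸ suc (toℕ u) < toℕ v ∸ toℕ u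
    gap = ∸-monoʳ-< (n<1+n (toℕ u)) u<v
    distRE-vert : distRE (path n) L (vert x) v ≡ toℕ v ∸ toℕ u
    distRE-vert = begin
      distR (path n) L x v          ≡⟨ distR-path-above L (≤-trans (≤-reflexive x≡u) (<⇒≤ u<v)) ⟩
      (toℕ v ∸ toℕ x) ⊓ suc L       ≡⟨ cong (λ j → (toℕ v ∸ j) ⊓ suc L) x≡u ⟩
      (toℕ v ∸ toℕ u) ⊓ suc L       ≡⟨ m≤n⇒m⊓n≡m (m≤n⇒m≤1+n v∸u≤L) ⟩
      toℕ v ∸ toℕ u                 ∎
      where open ≡-Reasoning
    distRE-edge : distRE (path n) L (edge u w u<w a) v ≡ toℕ v ∸ suc (toℕ u)
    distRE-edge = begin
      distRE (path n) L (edge u w u<w a) v ≡⟨ distRE-above L (edge u w u<w a) v w≤v ⟩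
      (toℕ v ∸ toℕ w) ⊓ suc L             ≡⟨ cong (λ j → (toℕ v ∸ j) ⊓ suc L) (edge-high u<w a) ⟩
      (toℕ v ∸ suc (toℕ u)) ⊓ suc L       ≡⟨ m≤n⇒m⊓n≡m (m≤n⇒m≤1+n (≤-trans (<⇒≤ gap) v∸u≤L)) ⟩
      toℕ v ∸ suc (toℕ u)                 ∎
      where open ≡-Reasoning

  landmarks-resolving : IsMixedResolving (path n) L landmarks
  landmarks-resolving a b a≢b with <-cmp (low a) (low b)
  ... | tri< a<b _ _ = separate-by-low a b a<b
  ... | tri> _ _ b<a = Separated-sym b a (separate-by-low b a b<a)
  landmarks-resolving (vert x) (vert y) a≢b | tri≈ _ x≡y _ =
    contradiction (cong vert (Fin.toℕ-injective x≡y)) a≢b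
  landmarks-resolving (vert x) (edge u w u<w a) _ | tri≈ _ x≡u _ = separate-vertex-edge x u w u<w a x≡u
  landmarks-resolving (edge u w u<w a) (vert x) _ | tri≈ _ u≡x _ =
    Separated-sym (vert x) (edge u w u<w a) (separate-vertex-edge x u w u<w a (sym u≡x))
  landmarks-resolving (edge u w u<w a) (edge u′ w′ u′<w′ a′) a≢b | tri≈ _ u≡u′ _ =
    contradiction (edge-≡ (path n) (Fin.toℕ-injective u≡u′) (Fin.toℕ-injective w≡w′)) a≢b
    where
    w≡w′ : toℕ w ≡ toℕ w′
    w≡w′ = trans (edge-high u<w a) (trans (cong suc u≡u′) (sym (edge-high u′<w′ a′)))

  private
    slot : Fin n → Fin (suc (suc (n′ / L)))
    slot v with toℕ v % L ≟ 0
    ... | yes _ = Fin.fromℕ< (s≤s (m≤n⇒m≤1+n (/-monoˡ-≤ L (s≤s⁻¹ (Fin.toℕ<n v)))))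
    ... | no  _ = Fin.fromℕ (suc (n′ / L))

    multiple : ∀ (v : Fin n) → toℕ v % L ≡ 0 → toℕ v ≡ toℕ v / L * L
    multiple v v%L≡0 = trans (m≡m%n+[m/n]*n (toℕ v) L) (cong (_+ toℕ v / L * L) v%L≡0)

    slot-injective : ∀ {x y} → x ∈ landmarks → y ∈ landmarks → slot x ≡ slot y → x ≡ y
    slot-injective {x} {y} x∈ y∈ e
      with toℕ x % L ≟ 0 | toℕ y % L ≟ 0 | ∈-tabulate⁻ isLandmark? x∈ | ∈-tabulate⁻ isLandmark? y∈
    ... | yes x%L≡0 | yes y%L≡0 | _ | _ = Fin.toℕ-injective (begin
      toℕ x         ≡⟨ multiple x x%L≡0 ⟩
      toℕ x / L * L ≡⟨ cong (_* L) (trans (sym (Fin.toℕ-fromℕ< _)) (trans (cong toℕ e) (Fin.toℕ-fromℕ< _))) ⟩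
      toℕ y / L * L ≡⟨ multiple y y%L≡0 ⟨
      toℕ y         ∎)
      where open ≡-Reasoning
    ... | yes _ | no _ | _ | _ =
      contradiction (trans (sym (Fin.toℕ-fromℕ< _)) (trans (cong toℕ e) (Fin.toℕ-fromℕ _)))
                    (<⇒≢ (s≤s (/-monoˡ-≤ L (s≤s⁻¹ (Fin.toℕ<n x)))))
    ... | no _ | yes _ | _ | _ =
      contradiction (trans (sym (Fin.toℕ-fromℕ< _)) (trans (cong toℕ (sym e)) (Fin.toℕ-fromℕ _)))
                    (<⇒≢ (s≤s (/-monoˡ-≤ L (s≤s⁻¹ (Fin.toℕ<n y)))))
    ... | no x%L≢0 | no _ | inj₁ x%L≡0 | _ = contradiction x%L≡0 x%L≢0
    ... | no _ | no y%L≢0 | _ | inj₁ y%L≡0 = contradiction y%L≡0 y%L≢0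
    ... | no _ | no _ | inj₂ x≡n′ | inj₂ y≡n′ = Fin.toℕ-injective (trans x≡n′ (sym y≡n′))

  ∣landmarks∣≤ : ∣ landmarks ∣ ≤ suc (suc (n′ / L))
  ∣landmarks∣≤ = injectiveOn⇒∣S∣≤ landmarks slot slot-injective

-- Deciding whether th_mdim(T) ≤ k

ThresholdAtMost : ∀ {n} → Graph n → ℕ → Set
ThresholdAtMost G k = ∃ λ r → ∃ λ S → IsMixedResolving G r S × r + ∣ S ∣ ≤ k

module SameAdjacency {n : ℕ} (G H : Graph n) (adj≗ : ∀ u v → adj G u v ≡ adj H u v) where

  within≗ : ∀ k u v → within G k u v ≡ within H k u v
  within≗ zero    u v = refl
  within≗ (suc k) u v = cong₂ _∨_ (within≗ k u v)
    (cong or (map-cong (λ w → cong₂ _∧_ (adj≗ u w) (within≗ k w v)) (allFin n)))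

  distR≗ : ∀ r u v → distR G r u v ≡ distR H r u v
  distR≗ r u v = ≤-antisym
    (distR-mono G H (λ {k} {u} {v} w → within✓ (trans (within≗ k u v) (holds w))) r u v)
    (distR-mono H G (λ {k} {u} {v} w → within✓ (trans (sym (within≗ k u v)) (holds w))) r u v)

  connected⇒ : Connected G → Connected H
  connected⇒ c u v = proj₁ (c u v) , trans (sym (within≗ (proj₁ (c u v)) u v)) (proj₂ (c u v))

  walk⇐ : ∀ {u xs v} → WalkFrom H u xs v → WalkFrom G u xs v
  walk⇐ stop                 = stop
  walk⇐ (step {u} {w} a walk) = step (trans (adj≗ u w) a) (walk⇐ walk)

  acyclic⇒ : Acyclic G → Acyclic H
  acyclic⇒ acyclic c = acyclic record
    { start = start ; rest = rest ; end = end ; walk = walk⇐ walk ; long = long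
    ; closed = trans (adj≗ end start) closed ; unique = unique }
    where open Cycle c

  elem⇐ : Elem H → Elem G
  elem⇐ (vert x)       = vert x
  elem⇐ (edge u w p a) = edge u w p (trans (adj≗ u w) a)

  elem⇐-injective : ∀ a b → elem⇐ a ≡ elem⇐ b → a ≡ b
  elem⇐-injective a b e =
    key-injective H a b (trans (sym (key-elem⇐ a)) (trans (cong (key G) e) (key-elem⇐ b)))
    where
    key-elem⇐ : ∀ a → key G (elem⇐ a) ≡ key H a
    key-elem⇐ (vert _)       = refl
    key-elem⇐ (edge _ _ _ _) = refl

  distRE-elem⇐ : ∀ r a v → distRE G r (elem⇐ a) v ≡ distRE H r a v
  distRE-elem⇐ r (vert x)       v = distR≗ r x v
  distRE-elem⇐ r (edge u w _ _) v = cong₂ _⊓_ (distR≗ r u v) (distR≗ r w v)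

  resolving⇒ : ∀ {r S} → IsMixedResolving G r S → IsMixedResolving H r S
  resolving⇒ {r} resolving a b a≢b
    with v , v∈S , ≢ ← resolving (elem⇐ a) (elem⇐ b) (λ e → a≢b (elem⇐-injective a b e)) =
    v , v∈S , λ e → ≢ (trans (distRE-elem⇐ r a v) (trans e (sym (distRE-elem⇐ r b v))))

  tree⇒ : IsTree G → IsTree H
  tree⇒ (c , acyclic) = connected⇒ c , acyclic⇒ acyclic

  threshold⇒ : ∀ {k} → ThresholdAtMost G k → ThresholdAtMost H k
  threshold⇒ (r , S , resolving , le) = r , S , resolving⇒ resolving , le

module _ {n : ℕ} (G : Graph n) where

  connected? : Dec (Connected G)
  connected? = map′ (λ within-n u v → n , holds (within-n u v)) within-n
                    (Fin.all? λ u → Fin.all? λ v → Within? G n u v)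
    where
    within-n : Connected G → ∀ u v → Within G n u v
    within-n c u v = Within-mono G (<⇒≤ (depth<n u)) (depth-Within u)
      where open Rooted G c v

  walk? : ∀ u xs v → Dec (WalkFrom G u xs v)
  walk? u []       v = map′ (λ { refl → stop }) (λ { stop → refl }) (u Fin.≟ v)
  walk? u (w ∷ xs) v = map′ (λ (a , walk) → step a walk) (λ { (step a walk) → a , walk })
                            ((adj G u w Bool.≟ true) ×-dec walk? w xs v)

  cycle? : Dec (Cycle G)
  cycle? = map′ to from (Fin.any? λ s → Fin.any? λ e → any-list≤? n λ rest →
    walk? s rest e ×-dec 2 ≤? length rest ×-dec adj G e s Bool.≟ true ×-dec
    allPairs? (λ x y → ¬? (x Fin.≟ y)) (s ∷ rest))
    where
    Closed : Fin n → Fin n → List (Fin n) → Set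
    Closed s e rest = WalkFrom G s rest e × 2 ≤ length rest × Adj G e s × Unique (s ∷ rest)
    to : (∃ λ s → ∃ λ e → ShortWitness n (Closed s e)) → Cycle G
    to (s , e , rest , _ , walk , long , closed , unique) = record
      { start = s ; rest = rest ; end = e ; walk = walk ; long = long ; closed = closed ; unique = unique }
    from : Cycle G → ∃ λ s → ∃ λ e → ShortWitness n (Closed s e)
    from c = start , end , rest , ≤-trans (n≤1+n _) (unique⇒length≤ unique) , walk , long , closed , unique
      where open Cycle c

  tree? : Dec (IsTree G)
  tree? = connected? ×-dec ¬? cycle?

  all-elem? : {P : Elem G → Set} → Decidable P → Dec (∀ a → P a)
  all-elem? {P} P? = map′ (λ (vertices , edges) → λ { (vert x) → vertices x ; (edge u w p a) → edges u w p a })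
                          (λ all → (λ x → all (vert x)) , (λ u w p a → all (edge u w p a)))
                          (Fin.all? (λ x → P? (vert x)) ×-dec Fin.all? λ u → Fin.all? λ w → edges? u w)
    where
    edges? : ∀ u w → Dec (∀ p a → P (edge u w p a))
    edges? u w with toℕ u <? toℕ w | adj G u w Bool.≟ true
    ... | no  u≮w | _     = yes (λ p → contradiction p u≮w)
    ... | yes _   | no ¬a = yes (λ _ a → contradiction a ¬a)
    ... | yes p   | yes a =
      map′ (λ Pe _ _ → subst P (edge-≡ G refl refl) Pe) (λ all → all p a) (P? (edge u w p a))

  resolving? : ∀ r S → Dec (IsMixedResolving G r S)
  resolving? r S = all-elem? λ a → all-elem? λ b → ¬? (_≟ᴱ_ G a b) →-dec
    Fin.any? λ v → (v ∈? S) ×-dec ¬? (distRE G r a v ≟ distRE G r b v)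

  threshold? : ∀ k → Dec (ThresholdAtMost G k)
  threshold? k = map′ (λ (r , _ , t) → r , t)
                      (λ (r , S , t) → r , s≤s (≤-trans (m≤m+n r _) (proj₂ t)) , S , t)
    (anyUpTo? (λ r → anySubset? λ S → resolving? r S ×-dec r + ∣ S ∣ ≤? k) (suc k))

-- Graphs are searched through their adjacency matrices, flattened to subsets of Fin (n * n).
module _ (n : ℕ) where

  private
    adjOf : Subset (n * n) → Fin n → Fin n → Bool
    adjOf M u v = Vec.lookup M (Fin.combine u v)

    Simple : Subset (n * n) → Set
    Simple M = (∀ u v → adjOf M u v ≡ adjOf M v u) × (∀ u → adjOf M u u ≡ false)

    simple? : Decidable Simple
    simple? M = (Fin.all? λ u → Fin.all? λ v → adjOf M u v Bool.≟ adjOf M v u) ×-dec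
                (Fin.all? λ u → adjOf M u u Bool.≟ false)

    graphOf : (M : Subset (n * n)) → Simple M → Graph n
    graphOf M (s , i) = record { adj = adjOf M ; sym = s ; irrefl = i }

    encode : Graph n → Subset (n * n)
    encode T = tabulate λ i → uncurry (adj T) (Fin.remQuot n i)

    adjOf-encode : ∀ T u v → adjOf (encode T) u v ≡ adj T u v
    adjOf-encode T u v =
      trans (lookup∘tabulate _ (Fin.combine u v)) (cong (uncurry (adj T)) (Fin.remQuot-combine u v))

    Good : ℕ → Subset (n * n) → Set
    Good k M = Σ (Simple M) λ s → IsTree (graphOf M s) × ThresholdAtMost (graphOf M s) k

    good? : ∀ k → Decidable (Good k)
    good? k M with simple? M
    ... | no ¬s = no (¬s ∘ proj₁)
    ... | yes s = map′ (s ,_) (λ (s′ , t) → transfer (graphOf M s′) (graphOf M s) (λ _ _ → refl) t)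
                       (tree? (graphOf M s) ×-dec threshold? (graphOf M s) k)
      where
      transfer : ∀ G H → (∀ u v → adj G u v ≡ adj H u v) →
                 IsTree G × ThresholdAtMost G k → IsTree H × ThresholdAtMost H k
      transfer G H adj≗ = ×.map (SameAdjacency.tree⇒ G H adj≗) (SameAdjacency.threshold⇒ G H adj≗)

  TAtMost? : ∀ k → Dec (TAtMost n k)
  TAtMost? k = map′ (λ (M , s , t) → graphOf M s , t) from (anySubset? (good? k))
    where
    from : TAtMost n k → ∃ (Good k)
    from (T , tree , t) =
      encode T , simple , ×.map (SameAdjacency.tree⇒ T G adj≗) (SameAdjacency.threshold⇒ T G adj≗) (tree , t)
      where
      simple : Simple (encode T)
      simple = (λ u v → trans (adjOf-encode T u v) (trans (Graph.sym T u v) (sym (adjOf-encode T v u))))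
             , (λ u → trans (adjOf-encode T u u) (Graph.irrefl T u))
      G : Graph n
      G = graphOf (encode T) simple
      adj≗ : ∀ u v → adj T u v ≡ adj G u v
      adj≗ u v = sym (adjOf-encode T u v)

-- Bounds on t(n)

TAtMost-mono : ∀ {n k k′} → k ≤ k′ → TAtMost n k → TAtMost n k′
TAtMost-mono k≤k′ (T , tree , r , S , resolving , le) = T , tree , r , S , resolving , ≤-trans le k≤k′

TAtMost-path : ∀ n′ L′ → TAtMost (suc n′) (suc L′ + suc (suc (n′ / suc L′)))
TAtMost-path n′ L′ = path (suc n′) , (path-connected , path-acyclic) , suc L′ , landmarks ,
                     landmarks-resolving , +-monoʳ-≤ (suc L′) ∣landmarks∣≤
  where open Landmarks n′ L′

TAtMost⇒order≤ : ∀ {n′ m} → TAtMost (suc n′) m → n′ ≤ m * suc m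
TAtMost⇒order≤ (T , tree , r , S , resolving , le) =
  ≤-trans (tree-order-bound T tree resolving)
          (*-mono-≤ (≤-trans (m≤n+m _ r) le) (s≤s (≤-trans (m≤m+n r _) le)))

sqrt-floor : ∀ n → ∃ λ L → L * L ≤ n × n < suc L * suc L
sqrt-floor zero = 0 , z≤n , s≤s z≤n
sqrt-floor (suc n) with sqrt-floor n
... | L , L²≤n , n<[1+L]² with m≤n⇒m<n∨m≡n n<[1+L]²
... | inj₁ 1+n<[1+L]² = L , m≤n⇒m≤1+n L²≤n , 1+n<[1+L]²
... | inj₂ 1+n≡[1+L]² = suc L , ≤-reflexive (sym 1+n≡[1+L]²) , (begin-strict
  suc n                          ≡⟨ 1+n≡[1+L]² ⟩
  suc L * suc L                  <⟨ m<m+n (suc L * suc L) {3 + 2 * L} z<s ⟩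
  suc L * suc L + (3 + 2 * L)    ≡⟨ solve 1 (λ L → (con 1 :+ L) :* (con 1 :+ L) :+ (con 3 :+ con 2 :* L)
                                                   := (con 2 :+ L) :* (con 2 :+ L)) refl L ⟩
  suc (suc L) * suc (suc L)      ∎)
  where open ≤-Reasoning

m^2≡m*m : ∀ m → m ^ 2 ≡ m * m
m^2≡m*m m = cong (m *_) (*-identityʳ m)

1+n≤25m² : ∀ m {n′} → 1 ≤ n′ → n′ ≤ m * suc m → suc n′ ≤ 25 * m ^ 2
1+n≤25m² zero 1≤n′ n′≤0 = contradiction (≤-trans 1≤n′ n′≤0) λ ()
1+n≤25m² (suc k) {n′} _ n′≤ = begin
  suc n′                                           ≤⟨ s≤s n′≤ ⟩
  suc (suc k * suc (suc k))                        ≤⟨ m≤m+n _ (2 * (k * k) + 3 * k) ⟩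
  suc (suc k * suc (suc k)) + (2 * (k * k) + 3 * k) ≡⟨ solve 1 (λ k →
      (con 1 :+ (con 1 :+ k) :* (con 2 :+ k)) :+ (con 2 :* (k :* k) :+ con 3 :* k)
      := con 3 :* ((con 1 :+ k) :* (con 1 :+ k))) refl k ⟩
  3 * (suc k * suc k)                              ≤⟨ *-monoˡ-≤ (suc k * suc k) (m≤m+n 3 22) ⟩
  25 * (suc k * suc k)                             ≡⟨ cong (25 *_) (m^2≡m*m (suc k)) ⟨
  25 * suc k ^ 2                                   ∎
  where open ≤-Reasoning

path-cost≤5L : ∀ n′ L′ → suc n′ < suc (suc L′) * suc (suc L′) →
               suc L′ + suc (suc (n′ / suc L′)) ≤ 5 * suc L′
path-cost≤5L n′ L′ n<[1+L]² = begin
  L + (2 + n′ / L)     ≤⟨ +-monoʳ-≤ L (+-monoʳ-≤ 2 (s≤s⁻¹ n′/L<2+L)) ⟩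
  L + (2 + (1 + L))    ≤⟨ m≤m+n _ (3 * L′) ⟩
  L + (2 + (1 + L)) + 3 * L′ ≡⟨ solve 1 (λ L′ → ((con 1 :+ L′) :+ (con 2 :+ (con 1 :+ (con 1 :+ L′)))) :+ con 3 :* L′
                                           := con 5 :* (con 1 :+ L′)) refl L′ ⟩
  5 * L                ∎
  where
  open ≤-Reasoning
  L : ℕ
  L = suc L′
  n′<[2+L]*L : n′ < (2 + L) * L
  n′<[2+L]*L = s≤s⁻¹ (subst (suc n′ <_) (solve 1 (λ L′ → (con 2 :+ L′) :* (con 2 :+ L′)
                                                  := con 1 :+ (con 3 :+ L′) :* (con 1 :+ L′)) refl L′) n<[1+L]²)
  n′/L<2+L : n′ / L < 2 + L
  n′/L<2+L = m<n*o⇒m/o<n n′<[2+L]*L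

TAtMost-5L : ∀ n′ L′ → suc n′ < suc (suc L′) * suc (suc L′) → TAtMost (suc n′) (5 * suc L′)
TAtMost-5L n′ L′ n<[1+L]² = TAtMost-mono (path-cost≤5L n′ L′ n<[1+L]²) (TAtMost-path n′ L′)

t-bounds : ∀ n → 2 ≤ n → ∃ λ m → IsT n m × m ^ 2 ≤ 25 * n × n ≤ 25 * m ^ 2
t-bounds (suc n′) (s≤s 1≤n′) with sqrt-floor (suc n′)
... | zero , _ , s≤s ()
... | suc L′ , L²≤n , n<[1+L]² with least (TAtMost? (suc n′)) (TAtMost-5L n′ L′ n<[1+L]²)
... | m , t , minimal = m , (t , minimal) , m²≤25n , 1+n≤25m² m 1≤n′ (TAtMost⇒order≤ t)
  where
  L : ℕ
  L = suc L′
  m≤5L : m ≤ 5 * L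
  m≤5L = minimal _ (TAtMost-5L n′ L′ n<[1+L]²)
  m²≤25n : m ^ 2 ≤ 25 * suc n′
  m²≤25n = begin
    m ^ 2           ≡⟨ m^2≡m*m m ⟩
    m * m           ≤⟨ *-mono-≤ m≤5L m≤5L ⟩
    5 * L * (5 * L) ≡⟨ solve 1 (λ L → con 5 :* L :* (con 5 :* L) := con 25 :* (L :* L)) refl L ⟩
    25 * (L * L)    ≤⟨ *-monoʳ-≤ 25 L²≤n ⟩
    25 * suc n′     ∎
    where open ≤-Reasoning

mainTheorem10 : ∃ λ (C : ℕ) → ∃ λ (N : ℕ) → ∀ (n : ℕ) → N ≤ n →
    ∃ λ (m : ℕ) → IsT n m × (m ^ 2 ≤ suc C * n) × (n ≤ suc C * m ^ 2)
mainTheorem10 = 24 , 2 , t-bounds
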